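{- Let $\Gamma$ be a finite connected weighted graph. Then its Jacobian group $\mathrm{Jac}(\Gamma)$ is finite.
   Context: A weighted graph $\Gamma$ is a finite connected multigraph without loops, with vertex set $V(\Gamma)$, edge set $E(\Gamma)$, and weights $w: V(\Gamma)\cup E(\Gamma)\to\mathbb{Z}_{>0}$ such that the weight of each edge divides the weights of both of its endpoints. $E(v)$ denotes the set of edges incident to $v$ and $E(u,v)$ the set of edges joining $u$ and $v$. The weighted valency is $\mathrm{val}(v)=\sum_{e\in E(v)} w(v)/w(e)$. A divisor is a function $D:V(\Gamma)\to\mathbb{Z}$, with degree $\deg D=\sum_v D(v)$; $\mathrm{Div}^0(\Gamma)$ is the group of degree-zero divisors. A firing script is $\sigma:V(\Gamma)\to\mathbb{Z}$. With vertices $v_1,\dots,v_n$, the weighted Laplacian is the $n\times n$ integer matrix $L$ with $L_{ii}=\mathrm{val}(v_i)$ and $L_{ij} = -\sum_{e\in E(v_i,v_j)} w(v_j)/w(e)$ for $i\neq j$. The group of principal divisors is $\mathrm{Prin}(\Gamma)=\{L\sigma : \sigma\in\mathbb{Z}^{V(\Gamma)}\}$ (the divisors obtained from the zero divisor by weighted chip-firing), and $\mathrm{Jac}(\Gamma)=\mathrm{Div}^0(\Gamma)/\mathrm{Prin}(\Gamma)$. -}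

module Defs where

open import Data.Nat using (ℕ; zero; suc; NonZero)
open import Data.Nat.Divisibility using (_∣_; quotient)
open import Data.Integer as ℤ using (ℤ; +_; -_)
open import Data.Fin using (Fin; _≟_)
open import Data.List using (List; []; _∷_; allFin; foldr; map)
open import Data.List.Membership.Propositional using (_∈_)
open import Data.List.Relation.Unary.All using (All)
open import Data.List.Relation.Unary.Any using (Any)
open import Data.Product using (Σ; ∃; _×_; _,_)
open import Data.Sum using (_⊎_)
open import Relation.Nullary using (¬_; yes; no)
open import Relation.Binary.PropositionalEquality using (_≡_; _≢_; subst)

record Edge {n : ℕ} (vw : Fin n → ℕ) : Set where
  field
    src     : Fin n
    tgt     : Fin n
    wt      : ℕ
    wt-pos  : NonZero wt
    noLoop  : src ≢ tgt
    wt∣src  : wt ∣ vw src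
    wt∣tgt  : wt ∣ vw tgt

record WeightedGraph (n : ℕ) : Set where
  field
    vw     : Fin n → ℕ
    vw-pos : (v : Fin n) → NonZero (vw v)
    edges  : List (Edge vw)

module _ {n : ℕ} (Γ : WeightedGraph n) where
  open WeightedGraph Γ
  open Edge
  Edge' = Edge vw

  Joins : Edge' → Fin n → Fin n → Set
  Joins e u v = (src e ≡ u × tgt e ≡ v) ⊎ (src e ≡ v × tgt e ≡ u)

  data Reachable : Fin n → Fin n → Set where
    here  : ∀ {u} → Reachable u u
    step  : ∀ {u w v} (e : Edge') → e ∈ edges → Joins e u w →
            Reachable w v → Reachable u v

  Connected : Set
  Connected = ∀ u v → Reachable u v

  endRatio : Edge' → Fin n → ℕ
  endRatio e v with src e ≟ v
  ... | yes p = quotient (subst (λ x → wt e ∣ vw x) p (wt∣src e))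
  ... | no _ with tgt e ≟ v
  ...   | yes q = quotient (subst (λ x → wt e ∣ vw x) q (wt∣tgt e))
  ...   | no _  = 0

  joinRatio : Edge' → Fin n → Fin n → ℕ
  joinRatio e u v with src e ≟ u | tgt e ≟ v | src e ≟ v | tgt e ≟ u
  ... | yes _ | yes _ | _     | _     = endRatio e v
  ... | _     | _     | yes _ | yes _ = endRatio e v
  ... | _     | _     | _     | _     = 0

  sumℕ : List ℕ → ℕ
  sumℕ = foldr Data.Nat._+_ 0

  val : Fin n → ℕ
  val v = sumℕ (map (λ e → endRatio e v) edges)

  Laplacian : Fin n → Fin n → ℤ
  Laplacian i j with i ≟ j
  ... | yes _ = + val i
  ... | no _  = - (+ sumℕ (map (λ e → joinRatio e i j) edges))

Divisor : ℕ → Set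
Divisor n = Fin n → ℤ

∑ : ∀ {n} → (Fin n → ℤ) → ℤ
∑ {n} f = foldr ℤ._+_ (+ 0) (map f (allFin n))

deg : ∀ {n} → Divisor n → ℤ
deg D = ∑ D

IsDeg0 : ∀ {n} → Divisor n → Set
IsDeg0 D = deg D ≡ + 0

module _ {n : ℕ} (Γ : WeightedGraph n) where
  applyL : (Fin n → ℤ) → Divisor n
  applyL σ i = ∑ (λ j → Laplacian Γ i j ℤ.* σ j)

  IsPrincipal : Divisor n → Set
  IsPrincipal D = Σ (Fin n → ℤ) λ σ → ∀ i → D i ≡ applyL σ i

  LinEquiv : Divisor n → Divisor n → Set
  LinEquiv D D' = IsPrincipal (λ i → D i ℤ.- D' i)

  -- Jac(Γ) is finite: finitely many degree-zero divisors represent every class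
  JacFinite : Set
  JacFinite = Σ (List (Divisor n)) λ reps →
                All IsDeg0 reps ×
                (∀ (D : Divisor n) → IsDeg0 D → Any (LinEquiv D) reps)

-- Rescaling firing scripts by s(v) = P / w(v), where P is the product of all vertex weights,
-- turns the weighted Laplacian into the Laplacian of an ordinary symmetric network whose edge e
-- has integer conductance P / w(e). In such a network some positive multiple of δ_u - δ_w is a
-- Laplacian image for every edge uw: eliminate the other vertices one at a time by Kron reduction,
-- which keeps the conductance of uw positive and ends with the single edge uw, and lift the
-- potential back through each elimination. Along walks these relations compose, so for a fixed
-- vertex q every δ_v - δ_q has some finite order N_v in Jac. Reducing D(v) modulo N_v and moving
-- the remaining degree to q leaves only the finitely many representatives with 0 ≤ D(v) < N_v.
module Submission where

open import Algebra.Bundles using (Semiring)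
import Algebra.Properties.Semiring.Sum as SemiringSum
open import Data.Fin using (Fin; zero; suc; _≟_)
open import Data.Fin.Properties using (suc-injective)
open import Data.Integer using (ℤ; +_; -_; _+_; _*_; _-_)
open import Data.Integer.DivMod using (_%ℕ_; _/ℕ_; a≡a%ℕn+[a/ℕn]*n; n%ℕd<d)
import Data.Integer.Properties as ℤP
open import Data.Integer.Tactic.RingSolver using (solve-∀)
open import Data.List
  using (List; []; _∷_; [_]; map; foldr; tabulate; allFin; length; lookup; upTo; cartesianProductWith)
open import Data.List.Membership.Propositional using (_∈_)
open import Data.List.Membership.Propositional.Properties
  using (∈-allFin; ∈-map⁺; ∈-map⁻; ∈-upTo⁺; ∈-cartesianProductWith⁺)
import Data.List.Properties as List
import Data.List.Relation.Unary.All as All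
open import Data.List.Relation.Unary.All using (All)
open import Data.List.Relation.Unary.All.Properties using (map⁺)
import Data.List.Relation.Unary.Any as Any
open import Data.List.Relation.Unary.Any using (here)
open import Data.List.Relation.Unary.Any.Properties using (lookup-index)
open import Data.Nat as ℕ using (ℕ; zero; suc; NonZero; _<_)
open import Data.Nat.Divisibility using (_∣_; quotient; ∣-trans)
open import Data.Nat.ListAction using (product)
open import Data.Nat.ListAction.Properties using (∈⇒∣product; product≢0)
import Data.Nat.Properties as ℕP
import Data.Nat.Tactic.RingSolver as ℕSolver
open import Data.Product using (Σ; _×_; _,_; proj₁; proj₂)
open import Data.Sum as Sum using (_⊎_; inj₁; inj₂)
open import Data.Vec as Vec using (Vec; []; _∷_)
import Data.Vec.Properties as Vec
open import Data.Vec.Functional using (Vector; updateAt)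
open import Data.Vec.Functional.Properties using (updateAt-updates; updateAt-minimal)
open import Function using (_∘_; const)
open import Relation.Binary.PropositionalEquality
  using (_≡_; _≢_; refl; sym; trans; cong; cong₂; subst; module ≡-Reasoning)
open import Relation.Nullary using (¬_; Dec; yes; no)
open import Relation.Nullary.Decidable using (_×-dec_; _⊎-dec_)
open import Relation.Nullary.Negation using (contradiction)

open import Defs

module _ {c ℓ} (R : Semiring c ℓ) where
  open Semiring R using (Carrier; _≈_; 0#; setoid; +-congˡ; +-congʳ; +-identityˡ; +-identityʳ)
    renaming (_+_ to _⊕_)
  open SemiringSum R using (sum; sum-cong-≋; sum-replicate-zero)
  open import Relation.Binary.Reasoning.Setoid setoid

  sum-single : ∀ {n} (f : Vector Carrier n) k → (∀ j → j ≢ k → f j ≈ 0#) → sum f ≈ f k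
  sum-single {suc n} f zero f≈0 = begin
    f zero ⊕ sum (f ∘ suc)         ≈⟨ +-congˡ (sum-cong-≋ (λ j → f≈0 (suc j) λ ())) ⟩
    f zero ⊕ sum {n} (λ _ → 0#)    ≈⟨ +-congˡ (sum-replicate-zero n) ⟩
    f zero ⊕ 0#                    ≈⟨ +-identityʳ (f zero) ⟩
    f zero                         ∎
  sum-single {suc n} f (suc k) f≈0 = begin
    f zero ⊕ sum (f ∘ suc)         ≈⟨ +-congʳ (f≈0 zero λ ()) ⟩
    0# ⊕ sum (f ∘ suc)             ≈⟨ +-identityˡ _ ⟩
    sum (f ∘ suc)                  ≈⟨ sum-single (f ∘ suc) k (λ j j≢k → f≈0 (suc j) (j≢k ∘ suc-injective)) ⟩
    f (suc k)                      ∎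

open SemiringSum ℤP.+-*-semiring using (sum; sum-cong-≗; sum-replicate-zero; ∑-distrib-+; *-distribˡ-sum)
module Σℕ = SemiringSum ℕP.+-*-semiring

∑≡sum : ∀ {n} (f : Fin n → ℤ) → ∑ f ≡ sum f
∑≡sum f = trans (cong (foldr _+_ (+ 0)) (List.map-tabulate (λ i → i) f)) (foldr-tabulate f)
  where
  foldr-tabulate : ∀ {m} (g : Fin m → ℤ) → foldr _+_ (+ 0) (tabulate g) ≡ sum g
  foldr-tabulate {zero} g = refl
  foldr-tabulate {suc m} g = cong (_+_ (g zero)) (foldr-tabulate (g ∘ suc))

sum-*ˡ : ∀ {n} c (f : Fin n → ℤ) → sum (λ i → c * f i) ≡ c * sum f
sum-*ˡ c f = sym (*-distribˡ-sum c f)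

sum-neg : ∀ {n} (f : Fin n → ℤ) → sum (λ i → - f i) ≡ - sum f
sum-neg {zero} f = refl
sum-neg {suc n} f =
  trans (cong (_+_ (- f zero)) (sum-neg (f ∘ suc))) (sym (ℤP.neg-distrib-+ (f zero) (sum (f ∘ suc))))

sum-distrib-- : ∀ {n} (f g : Fin n → ℤ) → sum (λ i → f i - g i) ≡ sum f - sum g
sum-distrib-- f g = trans (∑-distrib-+ f (λ i → - g i)) (cong (_+_ (sum f)) (sum-neg g))

+-sum : ∀ {n} (f : Fin n → ℕ) → + Σℕ.sum f ≡ sum (+_ ∘ f)
+-sum {zero} f = refl
+-sum {suc n} f = trans (ℤP.pos-+ (f zero) (Σℕ.sum (f ∘ suc))) (cong (_+_ (+ f zero)) (+-sum (f ∘ suc)))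

sum≡0⇒≡0 : ∀ {n} (f : Fin n → ℕ) → Σℕ.sum f ≡ 0 → ∀ i → f i ≡ 0
sum≡0⇒≡0 f Σf≡0 zero = ℕP.m+n≡0⇒m≡0 (f zero) Σf≡0
sum≡0⇒≡0 f Σf≡0 (suc i) = sum≡0⇒≡0 (f ∘ suc) (ℕP.m+n≡0⇒n≡0 (f zero) Σf≡0) i

nonZero-sum : ∀ {n} (f : Fin n → ℕ) k → NonZero (f k) → NonZero (Σℕ.sum f)
nonZero-sum f k fk≢0 = ℕ.≢-nonZero (λ Σf≡0 → ℕ.≢-nonZero⁻¹ (f k) {{fk≢0}} (sum≡0⇒≡0 f Σf≡0 k))

foldr-map≡sum-lookup : ∀ {A : Set} (f : A → ℕ) (xs : List A) → foldr ℕ._+_ 0 (map f xs) ≡ Σℕ.sum (f ∘ lookup xs)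
foldr-map≡sum-lookup f [] = refl
foldr-map≡sum-lookup f (x ∷ xs) = cong (f x ℕ.+_) (foldr-map≡sum-lookup f xs)

δ : ∀ {n} → Fin n → Fin n → ℤ
δ v i with v ≟ i
... | yes _ = + 1
... | no _  = + 0

δ-refl : ∀ {n} (v : Fin n) → δ v v ≡ + 1
δ-refl v with v ≟ v
... | yes _   = refl
... | no v≢v = contradiction refl v≢v

δ-≢ : ∀ {n} {v i : Fin n} → v ≢ i → δ v i ≡ + 0
δ-≢ {v = v} {i} v≢i with v ≟ i
... | yes v≡i = contradiction v≡i v≢i
... | no _    = refl

sum-δ* : ∀ {n} (v : Fin n) (f : Fin n → ℤ) → sum (λ i → δ v i * f i) ≡ f v
sum-δ* v f = trans (sum-single ℤP.+-*-semiring (λ i → δ v i * f i) v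
                     (λ i i≢v → trans (cong (_* f i) (δ-≢ (i≢v ∘ sym))) (ℤP.*-zeroˡ (f i))))
                   (trans (cong (_* f v) (δ-refl v)) (ℤP.*-identityˡ (f v)))

sum-*δ : ∀ {n} (i : Fin n) (f : Fin n → ℤ) → sum (λ v → f v * δ v i) ≡ f i
sum-*δ i f = trans (sum-single ℤP.+-*-semiring (λ v → f v * δ v i) i
                     (λ v v≢i → trans (cong (f v *_) (δ-≢ v≢i)) (ℤP.*-zeroʳ (f v))))
                   (trans (cong (f i *_) (δ-refl i)) (ℤP.*-identityʳ (f i)))

sum-weighted-difference : ∀ {n} (r : Fin n → ℕ) (y : Fin n → ℤ) c →
                          sum (λ j → + r j * (c - y j)) ≡ c * + Σℕ.sum r - sum (λ j → + r j * y j)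
sum-weighted-difference r y c = begin
  sum (λ j → + r j * (c - y j))
    ≡⟨ sum-cong-≗ (λ j → expand (+ r j) c (y j)) ⟩
  sum (λ j → c * + r j - + r j * y j)
    ≡⟨ sum-distrib-- (λ j → c * + r j) (λ j → + r j * y j) ⟩
  sum (λ j → c * + r j) - sum (λ j → + r j * y j)
    ≡⟨ cong (_- sum (λ j → + r j * y j)) (sum-*ˡ c (+_ ∘ r)) ⟩
  c * sum (+_ ∘ r) - sum (λ j → + r j * y j)
    ≡⟨ cong (λ t → c * t - sum (λ j → + r j * y j)) (sym (+-sum r)) ⟩
  c * + Σℕ.sum r - sum (λ j → + r j * y j) ∎
  where
  open ≡-Reasoning
  expand : ∀ r c y → r * (c - y) ≡ c * r - r * y
  expand = solve-∀

-- Symmetric networks and dipole potentials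

Conductance : ℕ → Set
Conductance n = Fin n → Fin n → ℕ

IsSymmetric : ∀ {n} → Conductance n → Set
IsSymmetric C = ∀ i j → C i j ≡ C j i

SupportedOn : ∀ {n} → List (Fin n) → Conductance n → Set
SupportedOn S C = ∀ i j → i ≢ j → All (i ≢_) S → C i j ≡ 0

supportedOn-allFin : ∀ {n} (C : Conductance n) a b → SupportedOn (a ∷ b ∷ allFin n) C
supportedOn-allFin C a b i j _ (_ All.∷ _ All.∷ i∉allFin) = contradiction refl (All.lookup i∉allFin (∈-allFin i))

supportedOn-drop : ∀ {n} {a b x : Fin n} {xs} (C : Conductance n) →
                   (∀ {i} → All (i ≢_) (a ∷ b ∷ xs) → i ≢ x) →
                   SupportedOn (a ∷ b ∷ x ∷ xs) C → SupportedOn (a ∷ b ∷ xs) C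
supportedOn-drop C i≢x supp i j i≢j i∉@(i≢a All.∷ i≢b All.∷ i∉xs) =
  supp i j i≢j (i≢a All.∷ i≢b All.∷ i≢x i∉ All.∷ i∉xs)

Δ : ∀ {n} → Conductance n → (Fin n → ℤ) → Fin n → ℤ
Δ C y i = sum (λ j → + C i j * (y i - y j))

DipolePotential : ∀ {n} → Conductance n → Fin n → Fin n → Set
DipolePotential {n} C a b = Σ ℕ λ N → NonZero N × Σ (Fin n → ℤ) λ y → ∀ i → Δ C y i ≡ + N * (δ a i - δ b i)

Δ-concentrated : ∀ {n} (C : Conductance n) y i k → (∀ j → j ≢ i → j ≢ k → C i j ≡ 0) →
                 Δ C y i ≡ + C i k * (y i - y k)
Δ-concentrated C y i k vanish = sum-single ℤP.+-*-semiring (λ j → + C i j * (y i - y j)) k term≡0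
  where
  term≡0 : ∀ j → j ≢ k → + C i j * (y i - y j) ≡ + 0
  term≡0 j j≢k with j ≟ i
  ... | yes refl = trans (cong (+ C i i *_) (ℤP.+-inverseʳ (y i))) (ℤP.*-zeroʳ (+ C i i))
  ... | no j≢i   = cong (λ c → + c * (y i - y j)) (vanish j j≢i j≢k)

dipole-single-edge : ∀ {n} {a b : Fin n} → a ≢ b → (C : Conductance n) → IsSymmetric C → NonZero (C a b) →
                     SupportedOn (a ∷ b ∷ []) C → DipolePotential C a b
dipole-single-edge {a = a} {b} a≢b C C-sym C≢0 supp = C a b , C≢0 , δ a , Δδ
  where
  column : ∀ {i} j → j ≢ i → j ≢ a → j ≢ b → C i j ≡ 0
  column {i} j j≢i j≢a j≢b = trans (C-sym i j) (supp j i j≢i (j≢a All.∷ j≢b All.∷ All.[]))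
  Δδ : ∀ i → Δ C (δ a) i ≡ + C a b * (δ a i - δ b i)
  Δδ i with i ≟ a | i ≟ b
  ... | yes refl | _ = trans (Δ-concentrated C (δ a) a b (λ j j≢a j≢b → column j j≢a j≢a j≢b))
                             (cong (λ t → + C a b * (δ a a - t)) (trans (δ-≢ a≢b) (sym (δ-≢ (a≢b ∘ sym)))))
  ... | no _ | yes refl = trans (Δ-concentrated C (δ a) b a (λ j j≢b j≢a → column j j≢b j≢a j≢b))
                                (cong₂ (λ c t → + c * (δ a b - t)) (C-sym b a) (trans (δ-refl a) (sym (δ-refl b))))
  ... | no i≢a | no i≢b = begin
    Δ C (δ a) i
      ≡⟨ Δ-concentrated C (δ a) i i (λ j j≢i _ → supp i j (j≢i ∘ sym) (i≢a All.∷ i≢b All.∷ All.[])) ⟩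
    + C i i * (δ a i - δ a i)
      ≡⟨ cong (+ C i i *_) (ℤP.+-inverseʳ (δ a i)) ⟩
    + C i i * + 0
      ≡⟨ ℤP.*-zeroʳ (+ C i i) ⟩
    + 0
      ≡⟨ sym (ℤP.*-zeroʳ (+ C a b)) ⟩
    + C a b * (+ 0 - + 0)
      ≡⟨ sym (cong₂ (λ s t → + C a b * (s - t)) (δ-≢ (i≢a ∘ sym)) (δ-≢ (i≢b ∘ sym))) ⟩
    + C a b * (δ a i - δ b i) ∎
    where open ≡-Reasoning

-- Kron reduction

offRow : ∀ {n} → Conductance n → Fin n → Fin n → ℕ
offRow C x = updateAt (C x) x (const 0)

offRow-≢ : ∀ {n} (C : Conductance n) {x j} → j ≢ x → offRow C x j ≡ C x j
offRow-≢ C {x} {j} j≢x = updateAt-minimal j x (C x) j≢x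

degree : ∀ {n} → Conductance n → Fin n → ℕ
degree C x = Σℕ.sum (offRow C x)

neighbourSum : ∀ {n} → Conductance n → Fin n → (Fin n → ℤ) → ℤ
neighbourSum C x y = sum (λ j → + offRow C x j * y j)

-- The Schur complement of the network at x, multiplied by the degree of x to stay integral.
eliminate : ∀ {n} → Fin n → Conductance n → Conductance n
eliminate x C i j with i ≟ x | j ≟ x
... | no _ | no _ = degree C x ℕ.* C i j ℕ.+ C i x ℕ.* C x j
... | _    | _    = 0

eliminate-≢ : ∀ {n} x (C : Conductance n) {i j} → i ≢ x → j ≢ x →
              eliminate x C i j ≡ degree C x ℕ.* C i j ℕ.+ C i x ℕ.* C x j
eliminate-≢ x C {i} {j} i≢x j≢x with i ≟ x | j ≟ x
... | yes i≡x | _       = contradiction i≡x i≢x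
... | no _    | yes j≡x = contradiction j≡x j≢x
... | no _    | no _    = refl

eliminate-row : ∀ {n} x (C : Conductance n) j → eliminate x C x j ≡ 0
eliminate-row x C j with x ≟ x
... | yes _   = refl
... | no x≢x = contradiction refl x≢x

eliminate-column : ∀ {n} x (C : Conductance n) i → eliminate x C i x ≡ 0
eliminate-column x C i with i ≟ x | x ≟ x
... | yes _ | _       = refl
... | no _  | yes _   = refl
... | no _  | no x≢x = contradiction refl x≢x

-- Degree times the harmonic extension of y to x; the scaling keeps it integral.
harmonicLift : ∀ {n} → Conductance n → Fin n → (Fin n → ℤ) → Fin n → ℤ
harmonicLift C x y = updateAt (λ j → + degree C x * y j) x (const (neighbourSum C x y))

harmonicLift-≢ : ∀ {n} (C : Conductance n) {x} y {j} → j ≢ x → harmonicLift C x y j ≡ + degree C x * y j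
harmonicLift-≢ C {x} y {j} j≢x = updateAt-minimal j x (λ j → + degree C x * y j) j≢x

harmonicLift-at : ∀ {n} (C : Conductance n) x y → harmonicLift C x y x ≡ neighbourSum C x y
harmonicLift-at C x y = updateAt-updates x (λ j → + degree C x * y j)

Δ-harmonicLift-at : ∀ {n} (C : Conductance n) x y → Δ C (harmonicLift C x y) x ≡ + 0
Δ-harmonicLift-at C x y = begin
  sum (λ j → + C x j * (z x - z j))
    ≡⟨ sum-cong-≗ term ⟩
  sum (λ j → + offRow C x j * (S - d * y j))
    ≡⟨ sum-weighted-difference (offRow C x) (λ j → d * y j) S ⟩
  S * d - sum (λ j → + offRow C x j * (d * y j))
    ≡⟨ cong (_-_ (S * d)) (trans (sum-cong-≗ (λ j → swap (+ offRow C x j) d (y j)))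
                                 (sum-*ˡ d (λ j → + offRow C x j * y j))) ⟩
  S * d - d * S
    ≡⟨ cancel S d ⟩
  + 0 ∎
  where
  open ≡-Reasoning
  z : Fin _ → ℤ
  z = harmonicLift C x y
  d S : ℤ
  d = + degree C x
  S = neighbourSum C x y
  swap : ∀ r d y → r * (d * y) ≡ d * (r * y)
  swap = solve-∀
  cancel : ∀ s d → s * d - d * s ≡ + 0
  cancel = solve-∀
  term : ∀ j → + C x j * (z x - z j) ≡ + offRow C x j * (S - d * y j)
  term j with j ≟ x
  ... | yes refl = trans (cong (+ C x x *_) (ℤP.+-inverseʳ (z x)))
                     (trans (ℤP.*-zeroʳ (+ C x x))
                            (sym (cong (λ c → + c * (S - d * y x)) (updateAt-updates x (C x)))))
  ... | no j≢x   = cong₂ (λ c t → + c * t) (sym (offRow-≢ C j≢x))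
                     (cong₂ _-_ (harmonicLift-at C x y) (harmonicLift-≢ C y j≢x))

eliminationDefect : ∀ {n} → Conductance n → Fin n → (Fin n → ℤ) → Fin n → Fin n → ℤ
eliminationDefect C x y i j = + offRow C x j * (y i - y j) - δ x j * (+ degree C x * y i - neighbourSum C x y)

sum-eliminationDefect : ∀ {n} (C : Conductance n) x y i → sum (eliminationDefect C x y i) ≡ + 0
sum-eliminationDefect C x y i = begin
  sum (eliminationDefect C x y i)
    ≡⟨ sum-distrib-- (λ j → + offRow C x j * (y i - y j)) (λ j → δ x j * (d * y i - S)) ⟩
  sum (λ j → + offRow C x j * (y i - y j)) - sum (λ j → δ x j * (d * y i - S))
    ≡⟨ cong₂ _-_ (sum-weighted-difference (offRow C x) y (y i)) (sum-δ* x (λ _ → d * y i - S)) ⟩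
  (y i * d - S) - (d * y i - S)
    ≡⟨ cancel (y i) d S ⟩
  + 0 ∎
  where
  open ≡-Reasoning
  d S : ℤ
  d = + degree C x
  S = neighbourSum C x y
  cancel : ∀ a d s → (a * d - s) - (d * a - s) ≡ + 0
  cancel = solve-∀

eliminate-term : ∀ {n} (C : Conductance n) x y {i} → i ≢ x → ∀ j →
                 + eliminate x C i j * (y i - y j) ≡
                 + C i j * (harmonicLift C x y i - harmonicLift C x y j) + + C i x * eliminationDefect C x y i j
eliminate-term C x y {i} i≢x j = cases j (j ≟ x)
  where
  open ≡-Reasoning
  d S : ℤ
  d = + degree C x
  S = neighbourSum C x y
  cases : ∀ j → Dec (j ≡ x) → + eliminate x C i j * (y i - y j) ≡
          + C i j * (harmonicLift C x y i - harmonicLift C x y j) + + C i x * eliminationDefect C x y i j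
  cases j (yes refl) = begin
    + eliminate x C i x * (y i - y x)
      ≡⟨ cong (λ c → + c * (y i - y x)) (eliminate-column x C i) ⟩
    + 0 * (y i - y x)
      ≡⟨ vanishing (+ C i x) (d * y i) S (y i - y x) ⟩
    + C i x * (d * y i - S) + + C i x * (+ 0 * (y i - y x) - + 1 * (d * y i - S))
      ≡⟨ sym (cong₂ (λ s t → + C i x * s + + C i x * t) (cong₂ _-_ (harmonicLift-≢ C y i≢x) (harmonicLift-at C x y))
                     (cong₂ (λ c e → + c * (y i - y x) - e * (d * y i - S)) (updateAt-updates x (C x)) (δ-refl x))) ⟩
    + C i x * (harmonicLift C x y i - harmonicLift C x y x) + + C i x * eliminationDefect C x y i x ∎
    where
    vanishing : ∀ c a s t → + 0 * (y i - y x) ≡ c * (a - s) + c * (+ 0 * t - + 1 * (a - s))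
    vanishing = solve-∀
  cases j (no j≢x) = begin
    + eliminate x C i j * (y i - y j)
      ≡⟨ cong (λ c → + c * (y i - y j)) (eliminate-≢ x C i≢x j≢x) ⟩
    + (degree C x ℕ.* C i j ℕ.+ C i x ℕ.* C x j) * (y i - y j)
      ≡⟨ cong (_* (y i - y j)) (trans (ℤP.pos-+ (degree C x ℕ.* C i j) (C i x ℕ.* C x j))
                                      (cong₂ _+_ (ℤP.pos-* (degree C x) (C i j)) (ℤP.pos-* (C i x) (C x j)))) ⟩
    (d * + C i j + + C i x * + C x j) * (y i - y j)
      ≡⟨ split (+ C i j) (+ C i x) (+ C x j) d (y i) (y j) S ⟩
    + C i j * (d * y i - d * y j) + + C i x * (+ C x j * (y i - y j) - + 0 * (d * y i - S))
      ≡⟨ sym (cong₂ (λ s t → + C i j * s + + C i x * t) (cong₂ _-_ (harmonicLift-≢ C y i≢x) (harmonicLift-≢ C y j≢x))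
                     (cong₂ (λ c e → + c * (y i - y j) - e * (d * y i - S)) (offRow-≢ C j≢x) (δ-≢ (j≢x ∘ sym)))) ⟩
    + C i j * (harmonicLift C x y i - harmonicLift C x y j) + + C i x * eliminationDefect C x y i j ∎
    where
    split : ∀ cij cix cxj d yi yj s →
            (d * cij + cix * cxj) * (yi - yj) ≡ cij * (d * yi - d * yj) + cix * (cxj * (yi - yj) - + 0 * (d * yi - s))
    split = solve-∀

Δ-harmonicLift : ∀ {n} (C : Conductance n) x y i → i ≢ x → Δ C (harmonicLift C x y) i ≡ Δ (eliminate x C) y i
Δ-harmonicLift C x y i i≢x = begin
  Δ C z i
    ≡⟨ sym (ℤP.+-identityʳ (Δ C z i)) ⟩
  Δ C z i + + 0
    ≡⟨ cong (_+_ (Δ C z i)) (sym defect≡0) ⟩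
  Δ C z i + sum (λ j → + C i x * E j)
    ≡⟨ sym (∑-distrib-+ (λ j → + C i j * (z i - z j)) (λ j → + C i x * E j)) ⟩
  sum (λ j → + C i j * (z i - z j) + + C i x * E j)
    ≡⟨ sum-cong-≗ (λ j → sym (eliminate-term C x y i≢x j)) ⟩
  Δ (eliminate x C) y i ∎
  where
  open ≡-Reasoning
  z E : Fin _ → ℤ
  z = harmonicLift C x y
  E = eliminationDefect C x y i
  defect≡0 : sum (λ j → + C i x * E j) ≡ + 0
  defect≡0 = trans (sum-*ˡ (+ C i x) E)
                   (trans (cong (+ C i x *_) (sum-eliminationDefect C x y i)) (ℤP.*-zeroʳ (+ C i x)))

dipole-eliminate : ∀ {n} (C : Conductance n) x {a b} → a ≢ x → b ≢ x →
                   DipolePotential (eliminate x C) a b → DipolePotential C a b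
dipole-eliminate C x {a} {b} a≢x b≢x (N , N≢0 , y , Δy) = N , N≢0 , harmonicLift C x y , Δz
  where
  Δz : ∀ i → Δ C (harmonicLift C x y) i ≡ + N * (δ a i - δ b i)
  Δz i with i ≟ x
  ... | yes refl = trans (Δ-harmonicLift-at C i y)
                         (sym (trans (cong₂ (λ s t → + N * (s - t)) (δ-≢ a≢x) (δ-≢ b≢x)) (ℤP.*-zeroʳ (+ N))))
  ... | no i≢x   = trans (Δ-harmonicLift C x y i i≢x) (Δy i)

eliminate-symmetric : ∀ {n} x (C : Conductance n) → IsSymmetric C → IsSymmetric (eliminate x C)
eliminate-symmetric x C C-sym i j = cases (i ≟ x) (j ≟ x)
  where
  cases : Dec (i ≡ x) → Dec (j ≡ x) → eliminate x C i j ≡ eliminate x C j i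
  cases (yes refl) _          = trans (eliminate-row x C j) (sym (eliminate-column x C j))
  cases (no _)     (yes refl) = trans (eliminate-column x C i) (sym (eliminate-row x C i))
  cases (no i≢x)   (no j≢x)   = begin
    eliminate x C i j                           ≡⟨ eliminate-≢ x C i≢x j≢x ⟩
    degree C x ℕ.* C i j ℕ.+ C i x ℕ.* C x j    ≡⟨ cong₂ (λ s t → degree C x ℕ.* s ℕ.+ t) (C-sym i j)
                                                    (trans (ℕP.*-comm (C i x) (C x j)) (cong₂ ℕ._*_ (C-sym x j) (C-sym i x))) ⟩
    degree C x ℕ.* C j i ℕ.+ C j x ℕ.* C x i    ≡⟨ sym (eliminate-≢ x C j≢x i≢x) ⟩
    eliminate x C j i                           ∎
    where open ≡-Reasoning

eliminate-supported : ∀ {n} {a b x : Fin n} {xs} (C : Conductance n) →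
                      SupportedOn (a ∷ b ∷ x ∷ xs) C → SupportedOn (a ∷ b ∷ xs) (eliminate x C)
eliminate-supported {x = x} C supp i j i≢j (i≢a All.∷ i≢b All.∷ i∉xs) = cases (i ≟ x) (j ≟ x)
  where
  cases : Dec (i ≡ x) → Dec (j ≡ x) → eliminate x C i j ≡ 0
  cases (yes refl) _          = eliminate-row x C j
  cases (no _)     (yes refl) = eliminate-column x C i
  cases (no i≢x)   (no j≢x)   = begin
    eliminate x C i j                           ≡⟨ eliminate-≢ x C i≢x j≢x ⟩
    degree C x ℕ.* C i j ℕ.+ C i x ℕ.* C x j    ≡⟨ cong₂ (λ s t → degree C x ℕ.* s ℕ.+ t ℕ.* C x j)
                                                    (supp i j i≢j i∉) (supp i x i≢x i∉) ⟩
    degree C x ℕ.* 0 ℕ.+ 0                      ≡⟨ cong (ℕ._+ 0) (ℕP.*-zeroʳ (degree C x)) ⟩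
    0                                           ∎
    where
    open ≡-Reasoning
    i∉ : All (i ≢_) (_ ∷ _ ∷ x ∷ _)
    i∉ = i≢a All.∷ i≢b All.∷ i≢x All.∷ i∉xs

eliminate-nonZero : ∀ {n} {a b x : Fin n} (C : Conductance n) → a ≢ x → b ≢ x →
                    NonZero (degree C x) → NonZero (C a b) → NonZero (eliminate x C a b)
eliminate-nonZero {a = a} {b} {x} C a≢x b≢x d≢0 C≢0 =
  subst NonZero (sym (eliminate-≢ x C a≢x b≢x)) (+-nonZero (ℕP.m*n≢0 (degree C x) (C a b) {{d≢0}} {{C≢0}}))
  where
  +-nonZero : ∀ {m k} → NonZero m → NonZero (m ℕ.+ k)
  +-nonZero {suc _} _ = _

isolated-supported : ∀ {n} {a b x : Fin n} {xs} (C : Conductance n) → degree C x ≡ 0 →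
                     SupportedOn (a ∷ b ∷ x ∷ xs) C → SupportedOn (a ∷ b ∷ xs) C
isolated-supported {x = x} C d≡0 supp i j i≢j (i≢a All.∷ i≢b All.∷ i∉xs) with i ≟ x
... | yes refl = trans (sym (offRow-≢ C (i≢j ∘ sym))) (sum≡0⇒≡0 (offRow C i) d≡0 j)
... | no i≢x   = supp i j i≢j (i≢a All.∷ i≢b All.∷ i≢x All.∷ i∉xs)

dipolePotential : ∀ {n} {a b : Fin n} → a ≢ b → ∀ xs (C : Conductance n) → IsSymmetric C → NonZero (C a b) →
                  SupportedOn (a ∷ b ∷ xs) C → DipolePotential C a b
dipolePotential a≢b [] C C-sym C≢0 supp = dipole-single-edge a≢b C C-sym C≢0 supp
dipolePotential {a = a} {b} a≢b (x ∷ xs) C C-sym C≢0 supp with x ≟ a | x ≟ b | degree C x ℕ.≟ 0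
... | yes refl | _        | _       =
  dipolePotential a≢b xs C C-sym C≢0 (supportedOn-drop C (λ { (i≢a All.∷ _) → i≢a }) supp)
... | no _     | yes refl | _       =
  dipolePotential a≢b xs C C-sym C≢0 (supportedOn-drop C (λ { (_ All.∷ i≢b All.∷ _) → i≢b }) supp)
... | no x≢a   | no x≢b   | yes d≡0 = dipolePotential a≢b xs C C-sym C≢0 (isolated-supported C d≡0 supp)
... | no x≢a   | no x≢b   | no d≢0  =
  dipole-eliminate C x (x≢a ∘ sym) (x≢b ∘ sym)
    (dipolePotential a≢b xs (eliminate x C) (eliminate-symmetric x C C-sym)
       (eliminate-nonZero C (x≢a ∘ sym) (x≢b ∘ sym) (ℕ.≢-nonZero d≢0) C≢0) (eliminate-supported C supp))

-- Representatives of degree-zero divisors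

normalize : ∀ {n} → Fin n → Divisor n → Divisor n
normalize q c i = c i - sum c * δ q i

normalize-deg0 : ∀ {n} (q : Fin n) (c : Divisor n) → IsDeg0 (normalize q c)
normalize-deg0 q c = begin
  ∑ (normalize q c)                    ≡⟨ ∑≡sum (normalize q c) ⟩
  sum (normalize q c)                  ≡⟨ sum-distrib-- c (λ i → sum c * δ q i) ⟩
  sum c - sum (λ i → sum c * δ q i)    ≡⟨ cong (_-_ (sum c)) (sum-cong-≗ (λ i → ℤP.*-comm (sum c) (δ q i))) ⟩
  sum c - sum (λ i → δ q i * sum c)    ≡⟨ cong (_-_ (sum c)) (sum-δ* q (λ _ → sum c)) ⟩
  sum c - sum c                        ≡⟨ ℤP.+-inverseʳ (sum c) ⟩
  + 0                                  ∎
  where open ≡-Reasoning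

sub-normalize : ∀ {n} (q : Fin n) {D : Divisor n} → IsDeg0 D → ∀ ρ i →
                D i - normalize q ρ i ≡ normalize q (λ v → D v - ρ v) i
sub-normalize q {D} D-deg0 ρ i = begin
  D i - (ρ i - sum ρ * δ q i)
    ≡⟨ regroup (D i) (ρ i) (sum ρ) (δ q i) ⟩
  D i - ρ i - (+ 0 - sum ρ) * δ q i
    ≡⟨ cong (λ s → D i - ρ i - (s - sum ρ) * δ q i) (trans (sym D-deg0) (∑≡sum D)) ⟩
  D i - ρ i - (sum D - sum ρ) * δ q i
    ≡⟨ cong (λ s → D i - ρ i - s * δ q i) (sym (sum-distrib-- D ρ)) ⟩
  normalize q (λ v → D v - ρ v) i ∎
  where
  open ≡-Reasoning
  regroup : ∀ d r s x → d - (r - s * x) ≡ d - r - (+ 0 - s) * x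
  regroup = solve-∀

box : ∀ {n} → (Fin n → ℕ) → List (Vec ℕ n)
box {zero} N = [ [] ]
box {suc n} N = cartesianProductWith _∷_ (upTo (N zero)) (box (N ∘ suc))

∈-box : ∀ {n} (N : Fin n → ℕ) (r : Vec ℕ n) → (∀ i → Vec.lookup r i < N i) → r ∈ box N
∈-box {zero} N [] _ = here refl
∈-box {suc n} N (r ∷ rs) r<N = ∈-cartesianProductWith⁺ _∷_ (∈-upTo⁺ (r<N zero)) (∈-box (N ∘ suc) rs (r<N ∘ suc))

module _ {n : ℕ} (Γ : WeightedGraph n) where

  applyL-+ : ∀ σ τ i → applyL Γ (λ j → σ j + τ j) i ≡ applyL Γ σ i + applyL Γ τ i
  applyL-+ σ τ i = begin
    ∑ (λ j → L j * (σ j + τ j))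
      ≡⟨ ∑≡sum (λ j → L j * (σ j + τ j)) ⟩
    sum (λ j → L j * (σ j + τ j))
      ≡⟨ sum-cong-≗ (λ j → ℤP.*-distribˡ-+ (L j) (σ j) (τ j)) ⟩
    sum (λ j → L j * σ j + L j * τ j)
      ≡⟨ ∑-distrib-+ (λ j → L j * σ j) (λ j → L j * τ j) ⟩
    sum (λ j → L j * σ j) + sum (λ j → L j * τ j)
      ≡⟨ sym (cong₂ _+_ (∑≡sum (λ j → L j * σ j)) (∑≡sum (λ j → L j * τ j))) ⟩
    applyL Γ σ i + applyL Γ τ i ∎
    where
    open ≡-Reasoning
    L : Fin n → ℤ
    L = Laplacian Γ i

  applyL-* : ∀ c σ i → applyL Γ (λ j → c * σ j) i ≡ c * applyL Γ σ i
  applyL-* c σ i = begin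
    ∑ (λ j → L j * (c * σ j))    ≡⟨ ∑≡sum (λ j → L j * (c * σ j)) ⟩
    sum (λ j → L j * (c * σ j))  ≡⟨ sum-cong-≗ (λ j → swap (L j) c (σ j)) ⟩
    sum (λ j → c * (L j * σ j))  ≡⟨ sum-*ˡ c (λ j → L j * σ j) ⟩
    c * sum (λ j → L j * σ j)    ≡⟨ cong (c *_) (sym (∑≡sum (λ j → L j * σ j))) ⟩
    c * applyL Γ σ i             ∎
    where
    open ≡-Reasoning
    L : Fin n → ℤ
    L = Laplacian Γ i
    swap : ∀ a b x → a * (b * x) ≡ b * (a * x)
    swap = solve-∀

  principal-cong : ∀ {D E : Divisor n} → (∀ i → D i ≡ E i) → IsPrincipal Γ D → IsPrincipal Γ E
  principal-cong D≗E (σ , D≡Lσ) = σ , λ i → trans (sym (D≗E i)) (D≡Lσ i)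

  principal-zero : IsPrincipal Γ (λ _ → + 0)
  principal-zero = (λ _ → + 0) , λ i → sym (trans (∑≡sum (λ j → Laplacian Γ i j * + 0))
                                              (trans (sum-cong-≗ (λ j → ℤP.*-zeroʳ (Laplacian Γ i j))) (sum-replicate-zero n)))

  principal-+ : ∀ {D E : Divisor n} → IsPrincipal Γ D → IsPrincipal Γ E → IsPrincipal Γ (λ i → D i + E i)
  principal-+ (σ , D≡Lσ) (τ , E≡Lτ) =
    (λ j → σ j + τ j) , λ i → trans (cong₂ _+_ (D≡Lσ i) (E≡Lτ i)) (sym (applyL-+ σ τ i))

  principal-* : ∀ c {D : Divisor n} → IsPrincipal Γ D → IsPrincipal Γ (λ i → c * D i)
  principal-* c (σ , D≡Lσ) = (λ j → c * σ j) , λ i → trans (cong (c *_) (D≡Lσ i)) (sym (applyL-* c σ i))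

  principal-sum : ∀ {m} (F : Fin m → Divisor n) → (∀ v → IsPrincipal Γ (F v)) →
                  IsPrincipal Γ (λ i → sum (λ v → F v i))
  principal-sum {zero} F _ = principal-zero
  principal-sum {suc m} F prin = principal-+ (prin zero) (principal-sum (F ∘ suc) (prin ∘ suc))

  record FiniteOrder (u v : Fin n) : Set where
    constructor finiteOrder
    field
      order     : ℕ
      order≢0   : NonZero order
      principal : IsPrincipal Γ (λ i → + order * (δ u i - δ v i))

  finiteOrder-refl : ∀ v → FiniteOrder v v
  finiteOrder-refl v = finiteOrder 1 _ (principal-cong vanish principal-zero)
    where
    vanish : ∀ i → + 0 ≡ + 1 * (δ v i - δ v i)
    vanish i = sym (trans (cong (+ 1 *_) (ℤP.+-inverseʳ (δ v i))) (ℤP.*-zeroʳ (+ 1)))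

  finiteOrder-trans : ∀ {u v w} → FiniteOrder u v → FiniteOrder v w → FiniteOrder u w
  finiteOrder-trans {u} {v} {w} (finiteOrder M M≢0 pM) (finiteOrder N N≢0 pN) =
    finiteOrder (M ℕ.* N) (ℕP.m*n≢0 M N {{M≢0}} {{N≢0}})
      (principal-cong combine (principal-+ (principal-* (+ N) pM) (principal-* (+ M) pN)))
    where
    telescope : ∀ m k a b c → k * (m * (a - b)) + m * (k * (b - c)) ≡ (m * k) * (a - c)
    telescope = solve-∀
    combine : ∀ i → + N * (+ M * (δ u i - δ v i)) + + M * (+ N * (δ v i - δ w i)) ≡
                    + (M ℕ.* N) * (δ u i - δ w i)
    combine i = trans (telescope (+ M) (+ N) (δ u i) (δ v i) (δ w i))
                      (cong (_* (δ u i - δ w i)) (sym (ℤP.pos-* M N)))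

  normalize-principal : ∀ q (N : Fin n → ℕ) → (∀ v → IsPrincipal Γ (λ i → + N v * (δ v i - δ q i))) →
                        ∀ (k c : Fin n → ℤ) → (∀ v → c v ≡ k v * + N v) → IsPrincipal Γ (normalize q c)
  normalize-principal q N prin k c c≡kN =
    principal-cong expand
      (principal-sum (λ v i → k v * (+ N v * (δ v i - δ q i))) (λ v → principal-* (k v) (prin v)))
    where
    open ≡-Reasoning
    distribute : ∀ k N x y → k * (N * (x - y)) ≡ k * N * x - y * (k * N)
    distribute = solve-∀
    expand : ∀ i → sum (λ v → k v * (+ N v * (δ v i - δ q i))) ≡ normalize q c i
    expand i = begin
      sum (λ v → k v * (+ N v * (δ v i - δ q i)))
        ≡⟨ sum-cong-≗ (λ v → trans (distribute (k v) (+ N v) (δ v i) (δ q i))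
                                   (cong (λ t → t * δ v i - δ q i * t) (sym (c≡kN v)))) ⟩
      sum (λ v → c v * δ v i - δ q i * c v)
        ≡⟨ sum-distrib-- (λ v → c v * δ v i) (λ v → δ q i * c v) ⟩
      sum (λ v → c v * δ v i) - sum (λ v → δ q i * c v)
        ≡⟨ cong₂ _-_ (sum-*δ i c) (sum-*ˡ (δ q i) c) ⟩
      c i - δ q i * sum c
        ≡⟨ cong (_-_ (c i)) (ℤP.*-comm (δ q i) (sum c)) ⟩
      normalize q c i ∎

  jacFinite : (q : Fin n) → (∀ v → FiniteOrder v q) → JacFinite Γ
  jacFinite q ord = map representative (box N) , All.tabulate deg0 , cover
    where
    open FiniteOrder
    N : Fin n → ℕ
    N v = order (ord v)
    representative : Vec ℕ n → Divisor n
    representative r = normalize q (λ v → + Vec.lookup r v)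
    deg0 : ∀ {D} → D ∈ map representative (box N) → IsDeg0 D
    deg0 D∈ with r , _ , refl ← ∈-map⁻ representative D∈ = normalize-deg0 q (λ v → + Vec.lookup r v)
    cover : ∀ D → IsDeg0 D → Any.Any (LinEquiv Γ D) (map representative (box N))
    cover D D-deg0 = Any.map (λ { refl → linEquiv }) (∈-map⁺ representative (∈-box N r r<N))
      where
      rem : Fin n → ℕ
      rem v = _%ℕ_ (D v) (N v) {{order≢0 (ord v)}}
      quo : Fin n → ℤ
      quo v = _/ℕ_ (D v) (N v) {{order≢0 (ord v)}}
      r : Vec ℕ n
      r = Vec.tabulate rem
      r<N : ∀ v → Vec.lookup r v < N v
      r<N v = subst (_< N v) (sym (Vec.lookup∘tabulate rem v)) (n%ℕd<d (D v) (N v) {{order≢0 (ord v)}})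
      D-r≡quo*N : ∀ v → D v - + Vec.lookup r v ≡ quo v * + N v
      D-r≡quo*N v = begin
        D v - + Vec.lookup r v
          ≡⟨ cong (λ t → D v - + t) (Vec.lookup∘tabulate rem v) ⟩
        D v - + rem v
          ≡⟨ cong (_- + rem v) (a≡a%ℕn+[a/ℕn]*n (D v) (N v) {{order≢0 (ord v)}}) ⟩
        + rem v + quo v * + N v - + rem v
          ≡⟨ cancel (+ rem v) (quo v * + N v) ⟩
        quo v * + N v ∎
        where
        open ≡-Reasoning
        cancel : ∀ a b → a + b - a ≡ b
        cancel = solve-∀
      linEquiv : LinEquiv Γ D (representative r)
      linEquiv = principal-cong (λ i → sym (sub-normalize q D-deg0 (λ v → + Vec.lookup r v) i))
                   (normalize-principal q N (principal ∘ ord) quo (λ v → D v - + Vec.lookup r v) D-r≡quo*N)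

  -- The rescaled symmetric network of a weighted graph

  open WeightedGraph Γ
  open Edge

  endRatio-endpoint : ∀ e {v} → src e ≡ v ⊎ tgt e ≡ v → endRatio Γ e v ℕ.* wt e ≡ vw v
  endRatio-endpoint e {v} end with src e ≟ v
  ... | yes p = sym (_∣_.equality (subst (λ u → wt e ∣ vw u) p (wt∣src e)))
  ... | no ¬p with tgt e ≟ v
  ...   | yes q = sym (_∣_.equality (subst (λ u → wt e ∣ vw u) q (wt∣tgt e)))
  endRatio-endpoint e (inj₁ p) | no ¬p | no _  = contradiction p ¬p
  endRatio-endpoint e (inj₂ q) | no _  | no ¬q = contradiction q ¬q

  endRatio-nonEndpoint : ∀ e {v} → src e ≢ v → tgt e ≢ v → endRatio Γ e v ≡ 0
  endRatio-nonEndpoint e {v} ¬p ¬q with src e ≟ v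
  ... | yes p = contradiction p ¬p
  ... | no _ with tgt e ≟ v
  ...   | yes q = contradiction q ¬q
  ...   | no _  = refl

  joinRatio-joins : ∀ e {i j} → Joins Γ e i j → joinRatio Γ e i j ℕ.* wt e ≡ vw j
  joinRatio-joins e (inj₁ (refl , refl)) with src e ≟ src e | tgt e ≟ tgt e
  ... | yes _ | yes _ = endRatio-endpoint e (inj₂ refl)
  ... | no ¬p | _     = contradiction refl ¬p
  ... | yes _ | no ¬q = contradiction refl ¬q
  joinRatio-joins e (inj₂ (refl , refl)) with src e ≟ tgt e | tgt e ≟ src e | src e ≟ src e | tgt e ≟ tgt e
  ... | yes s≡t | _ | _     | _     = contradiction s≡t (noLoop e)
  ... | no _    | _ | yes _ | yes _ = endRatio-endpoint e (inj₁ refl)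
  ... | no _    | _ | no ¬p | _     = contradiction refl ¬p
  ... | no _    | _ | yes _ | no ¬q = contradiction refl ¬q

  joinRatio-¬joins : ∀ e {i j} → ¬ Joins Γ e i j → joinRatio Γ e i j ≡ 0
  joinRatio-¬joins e {i} {j} ¬J with src e ≟ i | tgt e ≟ j | src e ≟ j | tgt e ≟ i
  ... | yes p | yes q | _     | _     = contradiction (inj₁ (p , q)) ¬J
  ... | _     | _     | yes p | yes q = contradiction (inj₂ (p , q)) ¬J
  ... | no _  | _     | no _  | _     = refl
  ... | no _  | _     | yes _ | no _  = refl
  ... | yes _ | no _  | no _  | _     = refl
  ... | yes _ | no _  | yes _ | no _  = refl

  joins? : ∀ e i j → Dec (Joins Γ e i j)
  joins? e i j = (src e ≟ i ×-dec tgt e ≟ j) ⊎-dec (src e ≟ j ×-dec tgt e ≟ i)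

  joins-distinct : ∀ e {i j} → Joins Γ e i j → i ≢ j
  joins-distinct e (inj₁ (s≡i , t≡j)) i≡j = noLoop e (trans s≡i (trans i≡j (sym t≡j)))
  joins-distinct e (inj₂ (s≡j , t≡i)) i≡j = noLoop e (trans s≡j (trans (sym i≡j) (sym t≡i)))

  commonMultiple : ℕ
  commonMultiple = product (map vw (allFin n))

  vw∣commonMultiple : ∀ v → vw v ∣ commonMultiple
  vw∣commonMultiple v = ∈⇒∣product (∈-map⁺ vw (∈-allFin v))

  wt∣commonMultiple : ∀ e → wt e ∣ commonMultiple
  wt∣commonMultiple e = ∣-trans (wt∣src e) (vw∣commonMultiple (src e))

  scale : Fin n → ℕ
  scale v = quotient (vw∣commonMultiple v)

  edgeConductance : Edge vw → ℕ
  edgeConductance e = quotient (wt∣commonMultiple e)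

  edgeConductance≢0 : ∀ e → NonZero (edgeConductance e)
  edgeConductance≢0 e = ℕP.m*n≢0⇒m≢0 (edgeConductance e)
    {{subst NonZero (_∣_.equality (wt∣commonMultiple e)) (product≢0 (map⁺ (All.universal vw-pos (allFin n))))}}

  rescale : ∀ e r {v} → r ℕ.* wt e ≡ vw v → r ℕ.* scale v ≡ edgeConductance e
  rescale e r {v} r*wt≡vw = ℕP.*-cancelʳ-≡ (r ℕ.* scale v) (edgeConductance e) (wt e) {{wt-pos e}} (begin
    r ℕ.* scale v ℕ.* wt e        ≡⟨ reorder r (scale v) (wt e) ⟩
    scale v ℕ.* (r ℕ.* wt e)      ≡⟨ cong (scale v ℕ.*_) r*wt≡vw ⟩
    scale v ℕ.* vw v              ≡⟨ sym (_∣_.equality (vw∣commonMultiple v)) ⟩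
    commonMultiple                ≡⟨ _∣_.equality (wt∣commonMultiple e) ⟩
    edgeConductance e ℕ.* wt e    ∎)
    where
    open ≡-Reasoning
    reorder : ∀ a b c → a ℕ.* b ℕ.* c ≡ b ℕ.* (a ℕ.* c)
    reorder = ℕSolver.solve-∀

  edgeContribution : Edge vw → Conductance n
  edgeContribution e i j = joinRatio Γ e i j ℕ.* scale j

  edgeContribution-joins : ∀ e {i j} → Joins Γ e i j → edgeContribution e i j ≡ edgeConductance e
  edgeContribution-joins e {i} {j} J = rescale e (joinRatio Γ e i j) (joinRatio-joins e J)

  edgeContribution-¬joins : ∀ e {i j} → ¬ Joins Γ e i j → edgeContribution e i j ≡ 0
  edgeContribution-¬joins e {j = j} ¬J = cong (ℕ._* scale j) (joinRatio-¬joins e ¬J)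

  edgeContribution-symmetric : ∀ e → IsSymmetric (edgeContribution e)
  edgeContribution-symmetric e i j with joins? e i j
  ... | yes J = trans (edgeContribution-joins e J) (sym (edgeContribution-joins e (Sum.swap J)))
  ... | no ¬J = trans (edgeContribution-¬joins e ¬J) (sym (edgeContribution-¬joins e (¬J ∘ Sum.swap)))

  edgeContribution-rowSum : ∀ e i → Σℕ.sum (edgeContribution e i) ≡ endRatio Γ e i ℕ.* scale i
  edgeContribution-rowSum e i = cases (src e ≟ i) (tgt e ≟ i)
    where
    open ≡-Reasoning
    cases : Dec (src e ≡ i) → Dec (tgt e ≡ i) → Σℕ.sum (edgeContribution e i) ≡ endRatio Γ e i ℕ.* scale i
    cases (yes refl) _ = begin
      Σℕ.sum (edgeContribution e (src e))              ≡⟨ sum-single ℕP.+-*-semiring (edgeContribution e (src e)) (tgt e)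
                                                    (λ j j≢t → edgeContribution-¬joins e (noJoin j≢t)) ⟩
      edgeContribution e (src e) (tgt e)
        ≡⟨ edgeContribution-joins e (inj₁ (refl , refl)) ⟩
      edgeConductance e
        ≡⟨ sym (rescale e (endRatio Γ e (src e)) (endRatio-endpoint e (inj₁ refl))) ⟩
      endRatio Γ e (src e) ℕ.* scale (src e) ∎
      where
      noJoin : ∀ {j} → j ≢ tgt e → ¬ Joins Γ e (src e) j
      noJoin j≢t (inj₁ (_ , t≡j)) = j≢t (sym t≡j)
      noJoin j≢t (inj₂ (_ , t≡s)) = noLoop e (sym t≡s)
    cases (no _) (yes refl) = begin
      Σℕ.sum (edgeContribution e (tgt e))              ≡⟨ sum-single ℕP.+-*-semiring (edgeContribution e (tgt e)) (src e)
                                                    (λ j j≢s → edgeContribution-¬joins e (noJoin j≢s)) ⟩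
      edgeContribution e (tgt e) (src e)
        ≡⟨ edgeContribution-joins e (inj₂ (refl , refl)) ⟩
      edgeConductance e
        ≡⟨ sym (rescale e (endRatio Γ e (tgt e)) (endRatio-endpoint e (inj₂ refl))) ⟩
      endRatio Γ e (tgt e) ℕ.* scale (tgt e) ∎
      where
      noJoin : ∀ {j} → j ≢ src e → ¬ Joins Γ e (tgt e) j
      noJoin j≢s (inj₁ (s≡t , _)) = noLoop e s≡t
      noJoin j≢s (inj₂ (s≡j , _)) = j≢s (sym s≡j)
    cases (no s≢i) (no t≢i) = begin
      Σℕ.sum (edgeContribution e i)
        ≡⟨ Σℕ.sum-cong-≗ (λ j → edgeContribution-¬joins e {i} {j} Sum.[ s≢i ∘ proj₁ , t≢i ∘ proj₂ ]) ⟩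
      Σℕ.sum {n} (λ _ → 0)
        ≡⟨ Σℕ.sum-replicate-zero n ⟩
      0
        ≡⟨ sym (cong (ℕ._* scale i) (endRatio-nonEndpoint e s≢i t≢i)) ⟩
      endRatio Γ e i ℕ.* scale i ∎

  edgeAt : Fin (length edges) → Edge vw
  edgeAt = lookup edges

  conductance : Conductance n
  conductance i j = Σℕ.sum (λ k → edgeContribution (edgeAt k) i j)

  conductance-symmetric : IsSymmetric conductance
  conductance-symmetric i j = Σℕ.sum-cong-≗ (λ k → edgeContribution-symmetric (edgeAt k) i j)

  conductance-nonZero : ∀ {e u w} → e ∈ edges → Joins Γ e u w → NonZero (conductance u w)
  conductance-nonZero {e} {u} {w} e∈ J = nonZero-sum (λ k → edgeContribution (edgeAt k) u w) (Any.index e∈)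
    (subst (λ e′ → NonZero (edgeContribution e′ u w)) (lookup-index e∈)
           (subst NonZero (sym (edgeContribution-joins e J)) (edgeConductance≢0 e)))

  conductance-diagonal : ∀ i → conductance i i ≡ 0
  conductance-diagonal i =
    trans (Σℕ.sum-cong-≗ (λ k → edgeContribution-¬joins (edgeAt k) (λ J → joins-distinct (edgeAt k) J refl)))
          (Σℕ.sum-replicate-zero (length edges))

  adjacency-scaled : ∀ i j → sumℕ Γ (map (λ e → joinRatio Γ e i j) edges) ℕ.* scale j ≡ conductance i j
  adjacency-scaled i j = trans (cong (ℕ._* scale j) (foldr-map≡sum-lookup (λ e → joinRatio Γ e i j) edges))
                               (Σℕ.*-distribʳ-sum (scale j) (λ k → joinRatio Γ (edgeAt k) i j))

  conductance-rowSum : ∀ i → Σℕ.sum (conductance i) ≡ val Γ i ℕ.* scale i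
  conductance-rowSum i = begin
    Σℕ.sum (λ j → Σℕ.sum (λ k → edgeContribution (edgeAt k) i j))
      ≡⟨ Σℕ.∑-comm (λ j k → edgeContribution (edgeAt k) i j) ⟩
    Σℕ.sum (λ k → Σℕ.sum (edgeContribution (edgeAt k) i))
      ≡⟨ Σℕ.sum-cong-≗ (λ k → edgeContribution-rowSum (edgeAt k) i) ⟩
    Σℕ.sum (λ k → endRatio Γ (edgeAt k) i ℕ.* scale i)
      ≡⟨ sym (Σℕ.*-distribʳ-sum (scale i) (λ k → endRatio Γ (edgeAt k) i)) ⟩
    Σℕ.sum (λ k → endRatio Γ (edgeAt k) i) ℕ.* scale i
      ≡⟨ cong (ℕ._* scale i) (sym (foldr-map≡sum-lookup (λ e → endRatio Γ e i) edges)) ⟩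
    val Γ i ℕ.* scale i ∎
    where open ≡-Reasoning

  laplacian-rescaled : ∀ i j (y : Fin n → ℤ) →
                       Laplacian Γ i j * (+ scale j * y j) ≡
                       δ i j * (+ (val Γ i ℕ.* scale i) * y i) - + conductance i j * y j
  laplacian-rescaled i j y with i ≟ j
  ... | yes refl = trans (diagonal (+ val Γ i) (+ scale i) (y i))
                         (cong₂ (λ v c → + 1 * (v * y i) - + c * y i)
                                (sym (ℤP.pos-* (val Γ i) (scale i))) (sym (conductance-diagonal i)))
    where
    diagonal : ∀ v s y → v * (s * y) ≡ + 1 * (v * s * y) - + 0 * y
    diagonal = solve-∀
  ... | no _ = trans (offDiagonal (+ A) (+ scale j) (y j) (+ (val Γ i ℕ.* scale i) * y i))
                     (cong (λ c → + 0 * (+ (val Γ i ℕ.* scale i) * y i) - c * y j)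
                           (trans (sym (ℤP.pos-* A (scale j))) (cong +_ (adjacency-scaled i j))))
    where
    A : ℕ
    A = sumℕ Γ (map (λ e → joinRatio Γ e i j) edges)
    offDiagonal : ∀ a s y v → - a * (s * y) ≡ + 0 * v - a * s * y
    offDiagonal = solve-∀

  applyL-rescaled : ∀ (y : Fin n → ℤ) i → applyL Γ (λ j → + scale j * y j) i ≡ Δ conductance y i
  applyL-rescaled y i = begin
    applyL Γ (λ j → + scale j * y j) i
      ≡⟨ ∑≡sum (λ j → Laplacian Γ i j * (+ scale j * y j)) ⟩
    sum (λ j → Laplacian Γ i j * (+ scale j * y j))
      ≡⟨ sum-cong-≗ (λ j → laplacian-rescaled i j y) ⟩
    sum (λ j → δ i j * V - K j)
      ≡⟨ sum-distrib-- (λ j → δ i j * V) K ⟩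
    sum (λ j → δ i j * V) - sum K
      ≡⟨ cong (_- sum K) (sum-δ* i (λ _ → V)) ⟩
    V - sum K
      ≡⟨ cong (_- sum K) (trans (ℤP.*-comm _ (y i)) (cong (λ t → y i * + t) (sym (conductance-rowSum i)))) ⟩
    y i * + Σℕ.sum (conductance i) - sum K
      ≡⟨ sym (sum-weighted-difference (conductance i) y (y i)) ⟩
    Δ conductance y i ∎
    where
    open ≡-Reasoning
    V : ℤ
    V = + (val Γ i ℕ.* scale i) * y i
    K : Fin n → ℤ
    K j = + conductance i j * y j

  finiteOrder-edge : ∀ {e u w} → e ∈ edges → Joins Γ e u w → FiniteOrder u w
  finiteOrder-edge {e} {u} {w} e∈ J =
    rescaled (dipolePotential (joins-distinct e J) (allFin n) conductance conductance-symmetric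
               (conductance-nonZero e∈ J) (supportedOn-allFin conductance u w))
    where
    rescaled : DipolePotential conductance u w → FiniteOrder u w
    rescaled (N , N≢0 , y , Δy) =
      finiteOrder N N≢0 ((λ j → + scale j * y j) , λ i → sym (trans (applyL-rescaled y i) (Δy i)))

  finiteOrder-reachable : ∀ {u v} → Reachable Γ u v → FiniteOrder u v
  finiteOrder-reachable here = finiteOrder-refl _
  finiteOrder-reachable (step e e∈ J rest) = finiteOrder-trans (finiteOrder-edge e∈ J) (finiteOrder-reachable rest)

mainTheorem4 : (n : ℕ) (Γ : WeightedGraph n) → Connected Γ → JacFinite Γ
mainTheorem4 zero Γ _ = [ (λ ()) ] , refl All.∷ All.[] , λ D _ → here ((λ ()) , λ ())
mainTheorem4 (suc n) Γ connected = jacFinite Γ zero (λ v → finiteOrder-reachable Γ (connected v zero))
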